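{- Let $N_1,N_2$ be nonnegative integers and $\mu_1\le\nu_1,\dots,\mu_k\le\nu_k$ nonnegative integers with $\sum_{i=1}^k(\mu_i+\nu_i)\le N_1+N_2$. Define \[f(x_1,x_2)=\sum_{c_1=\mu_1}^{\nu_1}\cdots\sum_{c_k=\mu_k}^{\nu_k}x_1^{N_1-c_1-\cdots-c_k}x_2^{c_1+\cdots+c_k-N_2}.\] Then \[\pi_1f(x_1,x_2)=\sum_{c_1=\mu_1}^{\nu_1}\cdots\sum_{c_k=\mu_k}^{\nu_k}\sum_{c_{k+1}=0}^{\nu_{k+1}}x_1^{N_1-c_1-\cdots-c_k-c_{k+1}}x_2^{c_1+\cdots+c_k+c_{k+1}-N_2},\] where $\nu_{k+1}=N_1+N_2-\sum_{i=1}^k(\mu_i+\nu_i)$.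
   Context: The isobaric divided difference (Demazure) operator $\pi_1$ acts on (Laurent) polynomials by $\pi_1f=\dfrac{x_1f-x_2\,s_1f}{x_1-x_2}$, where $s_1f$ is obtained from $f$ by swapping $x_1$ and $x_2$. -}

module Defs where

open import Data.Nat as ℕ using (ℕ; zero; suc; _∸_)
open import Data.Integer as ℤ using (ℤ; +_; _≟_)
open import Data.Fin using (Fin)
import Data.Fin as F
open import Data.List using (List; []; _∷_; _++_; map; concatMap; upTo; allFin)
open import Data.Nat.ListAction using (sum)
open import Data.Product using (_×_; _,_)
open import Relation.Nullary using (yes; no)
open import Relation.Nullary.Decidable using (_×-dec_)
open import Relation.Binary.PropositionalEquality using (_≡_)

-- Laurent polynomials in x₁, x₂ with integer coefficients, as formal
-- finite sums of terms  c · x₁^e₁ x₂^e₂  (c , e₁ , e₂).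

Term : Set
Term = ℤ × ℤ × ℤ

LPoly : Set
LPoly = List Term

coeff : LPoly → ℤ → ℤ → ℤ
coeff [] a b = + 0
coeff ((c , e₁ , e₂) ∷ p) a b with (e₁ ≟ a) ×-dec (e₂ ≟ b)
... | yes _ = c ℤ.+ coeff p a b
... | no  _ = coeff p a b

infix 4 _≈_
_≈_ : LPoly → LPoly → Set
p ≈ q = ∀ a b → coeff p a b ≡ coeff q a b

infixl 6 _⊕_ _⊖_
infixl 7 _⊛_

_⊕_ : LPoly → LPoly → LPoly
p ⊕ q = p ++ q

neg : LPoly → LPoly
neg = map (λ { (c , e₁ , e₂) → (ℤ.- c , e₁ , e₂) })

_⊖_ : LPoly → LPoly → LPoly
p ⊖ q = p ⊕ neg q

_⊛_ : LPoly → LPoly → LPoly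
p ⊛ q = concatMap (λ { (c , a₁ , a₂) →
          map (λ { (d , b₁ , b₂) → (c ℤ.* d , a₁ ℤ.+ b₁ , a₂ ℤ.+ b₂) }) q }) p

X₁ X₂ : LPoly
X₁ = (+ 1 , + 1 , + 0) ∷ []
X₂ = (+ 1 , + 0 , + 1) ∷ []

s₁ : LPoly → LPoly
s₁ = map (λ { (c , e₁ , e₂) → (c , e₂ , e₁) })

-- π₁ f = (x₁ f − x₂ s₁ f)/(x₁ − x₂).  Since x₁ − x₂ is a non-zero-divisor
-- in ℤ[x₁^±,x₂^±], "π₁ f = g" means exactly (x₁ − x₂) g = x₁ f − x₂ s₁ f.
_IsPi₁Of_ : LPoly → LPoly → Set
g IsPi₁Of f = (X₁ ⊖ X₂) ⊛ g ≈ X₁ ⊛ f ⊖ X₂ ⊛ s₁ f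

range : ℕ → ℕ → List ℕ
range μ ν = map (μ ℕ.+_) (upTo (suc ν ∸ μ))

boxSums : (k : ℕ) → (Fin k → ℕ) → (Fin k → ℕ) → List ℕ
boxSums zero    μ ν = 0 ∷ []
boxSums (suc k) μ ν =
  concatMap (λ c → map (c ℕ.+_) (boxSums k (λ i → μ (F.suc i)) (λ i → ν (F.suc i))))
            (range (μ F.zero) (ν F.zero))

mono : ℕ → ℕ → ℕ → Term
mono N₁ N₂ s = (+ 1 , (+ N₁) ℤ.- (+ s) , (+ s) ℤ.- (+ N₂))

totalμν : (k : ℕ) → (Fin k → ℕ) → (Fin k → ℕ) → ℕ
totalμν k μ ν = sum (map (λ i → μ i ℕ.+ ν i) (allFin k))

fPoly : ℕ → ℕ → (k : ℕ) → (Fin k → ℕ) → (Fin k → ℕ) → LPoly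
fPoly N₁ N₂ k μ ν = map (mono N₁ N₂) (boxSums k μ ν)

νlast : ℕ → ℕ → (k : ℕ) → (Fin k → ℕ) → (Fin k → ℕ) → ℕ
νlast N₁ N₂ k μ ν = (N₁ ℕ.+ N₂) ∸ totalμν k μ ν

rhsPoly : ℕ → ℕ → (k : ℕ) → (Fin k → ℕ) → (Fin k → ℕ) → LPoly
rhsPoly N₁ N₂ k μ ν =
  concatMap (λ s → map (λ c → mono N₁ N₂ (s ℕ.+ c)) (range 0 (νlast N₁ N₂ k μ ν)))
            (boxSums k μ ν)

{-# OPTIONS --safe #-}
-- Compare the coefficients of x₁^a x₂^b.  Write S for the list of box sums s = c₁ + ⋯ + c_k
-- and γ z for the coefficient of x₁^a x₂^b in x₁^(1 + N₁ − z) x₂^(z − N₂).  Multiplying the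
-- monomial x₁^(N₁ − s) x₂^(s − N₂) by x₁, by x₂, or applying s₁ and then multiplying by x₂
-- contributes γ s, γ (s + 1) and γ (N₁ + N₂ + 1 − s) respectively.  On the left the sum over
-- c_{k+1} telescopes to Σ_{s ∈ S} (γ s − γ (s + ν_{k+1} + 1)); on the right we get
-- Σ_{s ∈ S} (γ s − γ (N₁ + N₂ + 1 − s)).  These agree because S is palindromic: every range
-- [μᵢ, νᵢ] is invariant under c ↦ μᵢ + νᵢ − c, so S is invariant under s ↦ T − s, where
-- T = Σᵢ (μᵢ + νᵢ) = N₁ + N₂ − ν_{k+1}.
module Submission where

open import Defs
open import Data.Nat as ℕ using (ℕ; zero; suc; _≤_; _+_; _∸_)
import Data.Nat.Properties as ℕ
open import Data.Integer as ℤ using (ℤ; +_)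
import Data.Integer.Properties as ℤ
open import Data.Integer.Tactic.RingSolver using (solve-∀)
open import Data.Fin as Fin using (Fin)
open import Data.List using (List; []; _∷_; _++_; map; concatMap; upTo; applyUpTo)
import Data.List.Properties as List
open import Data.Nat.ListAction using (sum)
open import Data.Product using (_,_)
open import Function using (_∘_; id)
open import Relation.Nullary using (yes; no)
open import Relation.Nullary.Decidable using (_×-dec_)
open import Relation.Binary.PropositionalEquality
open ≡-Reasoning

private
  variable
    A B : Set

∑ : List A → (A → ℤ) → ℤ
∑ []       f = + 0
∑ (x ∷ xs) f = f x ℤ.+ ∑ xs f

infix 7 ∑
syntax ∑ xs (λ x → e) = ∑[ x ← xs ] e

∑-cong : ∀ (xs : List A) {f g : A → ℤ} → (∀ x → f x ≡ g x) → ∑ xs f ≡ ∑ xs g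
∑-cong []       f≗g = refl
∑-cong (x ∷ xs) f≗g = cong₂ ℤ._+_ (f≗g x) (∑-cong xs f≗g)

∑-++ : ∀ (xs ys : List A) (f : A → ℤ) → ∑ (xs ++ ys) f ≡ ∑ xs f ℤ.+ ∑ ys f
∑-++ []       ys f = sym (ℤ.+-identityˡ _)
∑-++ (x ∷ xs) ys f =
  trans (cong (ℤ._+_ (f x)) (∑-++ xs ys f)) (sym (ℤ.+-assoc (f x) _ _))

∑-map : (h : A → B) (xs : List A) (f : B → ℤ) → ∑ (map h xs) f ≡ ∑[ x ← xs ] f (h x)
∑-map h []       f = refl
∑-map h (x ∷ xs) f = cong (ℤ._+_ (f (h x))) (∑-map h xs f)

∑-concatMap : (F : A → List B) (xs : List A) (f : B → ℤ) →
              ∑ (concatMap F xs) f ≡ ∑[ x ← xs ] ∑ (F x) f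
∑-concatMap F []       f = refl
∑-concatMap F (x ∷ xs) f =
  trans (∑-++ (F x) (concatMap F xs) f) (cong (ℤ._+_ (∑ (F x) f)) (∑-concatMap F xs f))

∑-zero : ∀ (xs : List A) → ∑[ x ← xs ] + 0 ≡ + 0
∑-zero []       = refl
∑-zero (x ∷ xs) = trans (ℤ.+-identityˡ _) (∑-zero xs)

∑-distrib-+ : ∀ (xs : List A) (f g : A → ℤ) →
              ∑[ x ← xs ] (f x ℤ.+ g x) ≡ ∑ xs f ℤ.+ ∑ xs g
∑-distrib-+ []       f g = refl
∑-distrib-+ (x ∷ xs) f g =
  trans (cong (ℤ._+_ (f x ℤ.+ g x)) (∑-distrib-+ xs f g)) (interchange (f x) (g x) _ _)
  where
  interchange : ∀ p q r s → (p ℤ.+ q) ℤ.+ (r ℤ.+ s) ≡ (p ℤ.+ r) ℤ.+ (q ℤ.+ s)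
  interchange = solve-∀

∑-distrib-- : ∀ (xs : List A) (f g : A → ℤ) →
              ∑[ x ← xs ] (f x ℤ.- g x) ≡ ∑ xs f ℤ.- ∑ xs g
∑-distrib-- []       f g = refl
∑-distrib-- (x ∷ xs) f g =
  trans (cong (ℤ._+_ (f x ℤ.- g x)) (∑-distrib-- xs f g)) (interchange (f x) (g x) _ _)
  where
  interchange : ∀ p q r s → (p ℤ.- q) ℤ.+ (r ℤ.- s) ≡ (p ℤ.+ r) ℤ.- (q ℤ.+ s)
  interchange = solve-∀

∑-comm : (xs : List A) (ys : List B) (f : A → B → ℤ) →
         ∑[ x ← xs ] ∑[ y ← ys ] f x y ≡ ∑[ y ← ys ] ∑[ x ← xs ] f x y
∑-comm []       ys f = sym (∑-zero ys)
∑-comm (x ∷ xs) ys f =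
  trans (cong (ℤ._+_ (∑ ys (f x))) (∑-comm xs ys f)) (sym (∑-distrib-+ ys (f x) _))

∑-upTo-suc : ∀ n (f : ℕ → ℤ) → ∑[ i ← upTo (suc n) ] f i ≡ f 0 ℤ.+ ∑[ i ← upTo n ] f (suc i)
∑-upTo-suc n f = cong (ℤ._+_ (f 0)) (begin
  ∑ (applyUpTo suc n) f      ≡⟨ cong (λ is → ∑ is f) (List.map-applyUpTo id suc n) ⟨
  ∑ (map suc (upTo n)) f     ≡⟨ ∑-map suc (upTo n) f ⟩
  ∑[ i ← upTo n ] f (suc i)  ∎)

∑-upTo-∷ʳ : ∀ n (f : ℕ → ℤ) → ∑[ i ← upTo (suc n) ] f i ≡ ∑[ i ← upTo n ] f i ℤ.+ f n
∑-upTo-∷ʳ n f = begin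
  ∑ (upTo (suc n)) f              ≡⟨ cong (λ is → ∑ is f) (List.applyUpTo-∷ʳ id n) ⟨
  ∑ (upTo n ++ n ∷ []) f          ≡⟨ ∑-++ (upTo n) (n ∷ []) f ⟩
  ∑ (upTo n) f ℤ.+ (f n ℤ.+ + 0)  ≡⟨ cong (ℤ._+_ (∑ (upTo n) f)) (ℤ.+-identityʳ (f n)) ⟩
  ∑ (upTo n) f ℤ.+ f n            ∎

telescope : ∀ n (f : ℕ → ℤ) →
            (∑[ i ← upTo n ] f i) ℤ.- (∑[ i ← upTo n ] f (suc i)) ≡ f 0 ℤ.- f n
telescope zero    f = sym (ℤ.+-inverseʳ (f 0))
telescope (suc n) f = begin
  (∑[ i ← upTo (suc n) ] f i) ℤ.- (∑[ i ← upTo (suc n) ] f (suc i))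
    ≡⟨ cong₂ ℤ._-_ (∑-upTo-suc n f) (∑-upTo-∷ʳ n (f ∘ suc)) ⟩
  (f 0 ℤ.+ ∑[ i ← upTo n ] f (suc i)) ℤ.- (∑[ i ← upTo n ] f (suc i) ℤ.+ f (suc n))
    ≡⟨ cancel (f 0) _ (f (suc n)) ⟩
  f 0 ℤ.- f (suc n) ∎
  where
  cancel : ∀ p q r → (p ℤ.+ q) ℤ.- (q ℤ.+ r) ≡ p ℤ.- r
  cancel = solve-∀

∑-telescope : ∀ (xs : List A) n (f : A → ℕ → ℤ) →
              (∑[ x ← xs ] ∑[ i ← upTo n ] f x i) ℤ.- (∑[ x ← xs ] ∑[ i ← upTo n ] f x (suc i))
                ≡ (∑[ x ← xs ] f x 0) ℤ.- (∑[ x ← xs ] f x n)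
∑-telescope xs n f = begin
  (∑[ x ← xs ] ∑[ i ← upTo n ] f x i) ℤ.- (∑[ x ← xs ] ∑[ i ← upTo n ] f x (suc i))
    ≡⟨ ∑-distrib-- xs (λ x → ∑[ i ← upTo n ] f x i) (λ x → ∑[ i ← upTo n ] f x (suc i)) ⟨
  ∑[ x ← xs ] ((∑[ i ← upTo n ] f x i) ℤ.- (∑[ i ← upTo n ] f x (suc i)))
    ≡⟨ ∑-cong xs (λ x → telescope n (f x)) ⟩
  ∑[ x ← xs ] (f x 0 ℤ.- f x n)
    ≡⟨ ∑-distrib-- xs (λ x → f x 0) (λ x → f x n) ⟩
  (∑[ x ← xs ] f x 0) ℤ.- (∑[ x ← xs ] f x n) ∎

pos-∸ : ∀ {m n} → n ≤ m → + (m ∸ n) ≡ + m ℤ.- + n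
pos-∸ {m} {n} n≤m = trans (sym (ℤ.⊖-≥ n≤m)) (sym (ℤ.m-n≡m⊖n m n))

-- The multiset xs is invariant under x ↦ c − x.
record Palindromic (c : ℤ) (xs : List ℕ) : Set where
  constructor palindromic
  field
    reflect-∑ : ∀ (H : ℤ → ℤ) → ∑[ x ← xs ] H (+ x) ≡ ∑[ x ← xs ] H (c ℤ.- + x)

open Palindromic

upTo-palindromic : ∀ n → Palindromic (+ n ℤ.- + 1) (upTo n)
upTo-palindromic zero    = palindromic λ H → refl
upTo-palindromic (suc n) = palindromic λ H → begin
  ∑[ i ← upTo (suc n) ] H (+ i)
    ≡⟨ ∑-upTo-∷ʳ n (H ∘ +_) ⟩
  (∑[ i ← upTo n ] H (+ i)) ℤ.+ H (+ n)
    ≡⟨ cong₂ ℤ._+_ (reflect-∑ (upTo-palindromic n) H) (cong H (last (+ n))) ⟩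
  (∑[ i ← upTo n ] H (+ n ℤ.- + 1 ℤ.- + i)) ℤ.+ H (+ suc n ℤ.- + 1 ℤ.- + 0)
    ≡⟨ ℤ.+-comm (∑[ i ← upTo n ] H (+ n ℤ.- + 1 ℤ.- + i)) _ ⟩
  H (+ suc n ℤ.- + 1 ℤ.- + 0) ℤ.+ ∑[ i ← upTo n ] H (+ n ℤ.- + 1 ℤ.- + i)
    ≡⟨ cong (ℤ._+_ (H (+ suc n ℤ.- + 1 ℤ.- + 0)))
            (∑-cong (upTo n) (λ i → cong H (shift (+ n) (+ i)))) ⟩
  H (+ suc n ℤ.- + 1 ℤ.- + 0) ℤ.+ ∑[ i ← upTo n ] H (+ suc n ℤ.- + 1 ℤ.- + suc i)
    ≡⟨ ∑-upTo-suc n (λ i → H (+ suc n ℤ.- + 1 ℤ.- + i)) ⟨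
  ∑[ i ← upTo (suc n) ] H (+ suc n ℤ.- + 1 ℤ.- + i) ∎
  where
  last : ∀ n → n ≡ + 1 ℤ.+ n ℤ.- + 1 ℤ.- + 0
  last = solve-∀
  shift : ∀ n i → n ℤ.- + 1 ℤ.- i ≡ + 1 ℤ.+ n ℤ.- + 1 ℤ.- (+ 1 ℤ.+ i)
  shift = solve-∀

map-+-palindromic : ∀ m {c xs} → Palindromic c xs →
                    Palindromic (+ m ℤ.+ + m ℤ.+ c) (map (m ℕ.+_) xs)
map-+-palindromic m {c} {xs} xs-pal = palindromic λ H → begin
  ∑[ x ← map (m ℕ.+_) xs ] H (+ x)
    ≡⟨ ∑-map (m ℕ.+_) xs (H ∘ +_) ⟩
  ∑[ x ← xs ] H (+ m ℤ.+ + x)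
    ≡⟨ reflect-∑ xs-pal (λ z → H (+ m ℤ.+ z)) ⟩
  ∑[ x ← xs ] H (+ m ℤ.+ (c ℤ.- + x))
    ≡⟨ ∑-cong xs (λ x → cong H (regroup (+ m) c (+ x))) ⟩
  ∑[ x ← xs ] H (+ m ℤ.+ + m ℤ.+ c ℤ.- (+ m ℤ.+ + x))
    ≡⟨ ∑-map (m ℕ.+_) xs _ ⟨
  ∑[ x ← map (m ℕ.+_) xs ] H (+ m ℤ.+ + m ℤ.+ c ℤ.- + x) ∎
  where
  regroup : ∀ m c x → m ℤ.+ (c ℤ.- x) ≡ m ℤ.+ m ℤ.+ c ℤ.- (m ℤ.+ x)
  regroup = solve-∀

range-palindromic : ∀ {μ ν} → μ ≤ ν → Palindromic (+ μ ℤ.+ + ν) (range μ ν)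
range-palindromic {μ} {ν} μ≤ν = subst (λ c → Palindromic c (range μ ν)) centre
  (map-+-palindromic μ (upTo-palindromic (suc ν ∸ μ)))
  where
  simplify : ∀ m n → m ℤ.+ m ℤ.+ (+ 1 ℤ.+ n ℤ.- m ℤ.- + 1) ≡ m ℤ.+ n
  simplify = solve-∀
  centre : + μ ℤ.+ + μ ℤ.+ (+ (suc ν ∸ μ) ℤ.- + 1) ≡ + μ ℤ.+ + ν
  centre = begin
    + μ ℤ.+ + μ ℤ.+ (+ (suc ν ∸ μ) ℤ.- + 1)
      ≡⟨ cong (λ n → + μ ℤ.+ + μ ℤ.+ (n ℤ.- + 1)) (pos-∸ (ℕ.m≤n⇒m≤1+n μ≤ν)) ⟩
    + μ ℤ.+ + μ ℤ.+ (+ 1 ℤ.+ + ν ℤ.- + μ ℤ.- + 1)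
      ≡⟨ simplify (+ μ) (+ ν) ⟩
    + μ ℤ.+ + ν ∎

_⊞_ : List ℕ → List ℕ → List ℕ
xs ⊞ ys = concatMap (λ x → map (x ℕ.+_) ys) xs

∑-⊞ : ∀ xs ys (f : ℕ → ℤ) → ∑ (xs ⊞ ys) f ≡ ∑[ x ← xs ] ∑[ y ← ys ] f (x + y)
∑-⊞ xs ys f = trans (∑-concatMap _ xs f) (∑-cong xs (λ x → ∑-map (x ℕ.+_) ys f))

⊞-palindromic : ∀ {c d xs ys} → Palindromic c xs → Palindromic d ys →
                Palindromic (c ℤ.+ d) (xs ⊞ ys)
⊞-palindromic {c} {d} {xs} {ys} xs-pal ys-pal = palindromic λ H → begin
  ∑[ z ← xs ⊞ ys ] H (+ z)
    ≡⟨ ∑-⊞ xs ys (H ∘ +_) ⟩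
  ∑[ x ← xs ] ∑[ y ← ys ] H (+ x ℤ.+ + y)
    ≡⟨ ∑-cong xs (λ x → reflect-∑ ys-pal (λ z → H (+ x ℤ.+ z))) ⟩
  ∑[ x ← xs ] ∑[ y ← ys ] H (+ x ℤ.+ (d ℤ.- + y))
    ≡⟨ ∑-comm xs ys _ ⟩
  ∑[ y ← ys ] ∑[ x ← xs ] H (+ x ℤ.+ (d ℤ.- + y))
    ≡⟨ ∑-cong ys (λ y → reflect-∑ xs-pal (λ z → H (z ℤ.+ (d ℤ.- + y)))) ⟩
  ∑[ y ← ys ] ∑[ x ← xs ] H (c ℤ.- + x ℤ.+ (d ℤ.- + y))
    ≡⟨ ∑-comm ys xs _ ⟩
  ∑[ x ← xs ] ∑[ y ← ys ] H (c ℤ.- + x ℤ.+ (d ℤ.- + y))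
    ≡⟨ ∑-cong xs (λ x → ∑-cong ys (λ y → cong H (regroup c d (+ x) (+ y)))) ⟩
  ∑[ x ← xs ] ∑[ y ← ys ] H (c ℤ.+ d ℤ.- (+ x ℤ.+ + y))
    ≡⟨ ∑-⊞ xs ys (λ z → H (c ℤ.+ d ℤ.- + z)) ⟨
  ∑[ z ← xs ⊞ ys ] H (c ℤ.+ d ℤ.- + z) ∎
  where
  regroup : ∀ c d x y → c ℤ.- x ℤ.+ (d ℤ.- y) ≡ c ℤ.+ d ℤ.- (x ℤ.+ y)
  regroup = solve-∀

totalμν-suc : ∀ k (μ ν : Fin (suc k) → ℕ) →
              totalμν (suc k) μ ν ≡ μ Fin.zero + ν Fin.zero + totalμν k (μ ∘ Fin.suc) (ν ∘ Fin.suc)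
totalμν-suc k μ ν = cong (λ is → μ Fin.zero + ν Fin.zero + sum is)
  (trans (List.map-tabulate Fin.suc μ+ν) (sym (List.map-tabulate id (μ+ν ∘ Fin.suc))))
  where
  μ+ν : Fin (suc k) → ℕ
  μ+ν i = μ i + ν i

boxSums-palindromic : ∀ k (μ ν : Fin k → ℕ) → (∀ i → μ i ≤ ν i) →
                      Palindromic (+ totalμν k μ ν) (boxSums k μ ν)
boxSums-palindromic zero    μ ν μ≤ν = palindromic λ H → refl
boxSums-palindromic (suc k) μ ν μ≤ν =
  subst (λ c → Palindromic c (boxSums (suc k) μ ν)) (cong +_ (sym (totalμν-suc k μ ν)))
    (⊞-palindromic (range-palindromic (μ≤ν Fin.zero))
                   (boxSums-palindromic k (μ ∘ Fin.suc) (ν ∘ Fin.suc) (μ≤ν ∘ Fin.suc)))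

reflect-∑-shifted : ∀ {T S} n → Palindromic (+ T) S → T ≤ n → (H : ℤ → ℤ) →
                    ∑[ s ← S ] H (+ (s + suc (n ∸ T))) ≡ ∑[ s ← S ] H (+ suc n ℤ.- + s)
reflect-∑-shifted {T} {S} n S-pal T≤n H = begin
  ∑[ s ← S ] H (+ (s + suc (n ∸ T)))
    ≡⟨ ∑-cong S (λ s → cong (λ m → H (+ s ℤ.+ (+ 1 ℤ.+ m))) (pos-∸ T≤n)) ⟩
  ∑[ s ← S ] H (+ s ℤ.+ (+ 1 ℤ.+ (+ n ℤ.- + T)))
    ≡⟨ ∑-cong S (λ s → cong H (regroup (+ n) (+ T) (+ s))) ⟩
  ∑[ s ← S ] H (+ suc n ℤ.- (+ T ℤ.- + s))
    ≡⟨ reflect-∑ S-pal (λ z → H (+ suc n ℤ.- z)) ⟨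
  ∑[ s ← S ] H (+ suc n ℤ.- + s) ∎
  where
  regroup : ∀ n t s → s ℤ.+ (+ 1 ℤ.+ (n ℤ.- t)) ≡ + 1 ℤ.+ n ℤ.- (t ℤ.- s)
  regroup = solve-∀

coeff-⊕ : ∀ p q a b → coeff (p ⊕ q) a b ≡ coeff p a b ℤ.+ coeff q a b
coeff-⊕ []                  q a b = sym (ℤ.+-identityˡ _)
coeff-⊕ ((c , e₁ , e₂) ∷ p) q a b with (e₁ ℤ.≟ a) ×-dec (e₂ ℤ.≟ b)
... | yes _ = trans (cong (ℤ._+_ c) (coeff-⊕ p q a b)) (sym (ℤ.+-assoc c _ _))
... | no  _ = coeff-⊕ p q a b

coeff-neg : ∀ p a b → coeff (neg p) a b ≡ ℤ.- coeff p a b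
coeff-neg []                  a b = refl
coeff-neg ((c , e₁ , e₂) ∷ p) a b with (e₁ ℤ.≟ a) ×-dec (e₂ ℤ.≟ b)
... | yes _ = trans (cong (ℤ._+_ (ℤ.- c)) (coeff-neg p a b)) (sym (ℤ.neg-distrib-+ c _))
... | no  _ = coeff-neg p a b

coeff-⊖ : ∀ p q a b → coeff (p ⊖ q) a b ≡ coeff p a b ℤ.- coeff q a b
coeff-⊖ p q a b = trans (coeff-⊕ p (neg q) a b) (cong (ℤ._+_ (coeff p a b)) (coeff-neg q a b))

negT : Term → Term
negT (c , e₁ , e₂) = (ℤ.- c , e₁ , e₂)

swapT : Term → Term
swapT (c , e₁ , e₂) = (c , e₂ , e₁)

mulT : Term → Term → Term
mulT (c , a₁ , a₂) (d , b₁ , b₂) = (c ℤ.* d , a₁ ℤ.+ b₁ , a₂ ℤ.+ b₂)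

mulT-negT : ∀ t u → mulT (negT t) u ≡ negT (mulT t u)
mulT-negT (c , _) (d , _) = cong₂ _,_ (sym (ℤ.neg-distribˡ-* c d)) refl

neg-⊛ : ∀ p q → neg p ⊛ q ≡ neg (p ⊛ q)
neg-⊛ []      q = refl
neg-⊛ (t ∷ p) q = begin
  map (mulT (negT t)) q ++ neg p ⊛ q    ≡⟨ cong₂ _++_ (List.map-cong (mulT-negT t) q) (neg-⊛ p q) ⟩
  map (negT ∘ mulT t) q ++ neg (p ⊛ q)  ≡⟨ cong (_++ neg (p ⊛ q)) (List.map-∘ q) ⟩
  neg (map (mulT t) q) ++ neg (p ⊛ q)   ≡⟨ List.map-++ negT (map (mulT t) q) (p ⊛ q) ⟨
  neg ((t ∷ p) ⊛ q)                     ∎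

⊛-distribʳ-⊖ : ∀ p q r → (p ⊖ q) ⊛ r ≡ p ⊛ r ⊖ q ⊛ r
⊛-distribʳ-⊖ p q r = trans (List.concatMap-++ _ p (neg q)) (cong (p ⊛ r ⊕_) (neg-⊛ q r))

⊛-zeroʳ : ∀ p → p ⊛ [] ≡ []
⊛-zeroʳ []      = refl
⊛-zeroʳ (t ∷ p) = ⊛-zeroʳ p

coeff-⊛-distribˡ-⊕ : ∀ p q r a b →
                     coeff (p ⊛ (q ⊕ r)) a b ≡ coeff (p ⊛ q) a b ℤ.+ coeff (p ⊛ r) a b
coeff-⊛-distribˡ-⊕ []      q r a b = refl
coeff-⊛-distribˡ-⊕ (t ∷ p) q r a b = begin
  coeff (map (mulT t) (q ⊕ r) ⊕ p ⊛ (q ⊕ r)) a b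
    ≡⟨ coeff-⊕ (map (mulT t) (q ⊕ r)) (p ⊛ (q ⊕ r)) a b ⟩
  coeff (map (mulT t) (q ⊕ r)) a b ℤ.+ coeff (p ⊛ (q ⊕ r)) a b
    ≡⟨ cong₂ ℤ._+_ (trans (cong (λ u → coeff u a b) (List.map-++ (mulT t) q r)) (coeff-⊕ tq tr a b))
                   (coeff-⊛-distribˡ-⊕ p q r a b) ⟩
  (coeff tq a b ℤ.+ coeff tr a b) ℤ.+ (coeff (p ⊛ q) a b ℤ.+ coeff (p ⊛ r) a b)
    ≡⟨ interchange (coeff tq a b) (coeff tr a b) (coeff (p ⊛ q) a b) (coeff (p ⊛ r) a b) ⟩
  (coeff tq a b ℤ.+ coeff (p ⊛ q) a b) ℤ.+ (coeff tr a b ℤ.+ coeff (p ⊛ r) a b)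
    ≡⟨ cong₂ ℤ._+_ (coeff-⊕ tq (p ⊛ q) a b) (coeff-⊕ tr (p ⊛ r) a b) ⟨
  coeff ((t ∷ p) ⊛ q) a b ℤ.+ coeff ((t ∷ p) ⊛ r) a b ∎
  where
  tq = map (mulT t) q
  tr = map (mulT t) r
  interchange : ∀ w x y z → (w ℤ.+ x) ℤ.+ (y ℤ.+ z) ≡ (w ℤ.+ y) ℤ.+ (x ℤ.+ z)
  interchange = solve-∀

coeff-⊛-map : ∀ p (h : A → Term) xs a b →
              coeff (p ⊛ map h xs) a b ≡ ∑[ x ← xs ] coeff (p ⊛ (h x ∷ [])) a b
coeff-⊛-map p h []       a b = cong (λ q → coeff q a b) (⊛-zeroʳ p)
coeff-⊛-map p h (x ∷ xs) a b =
  trans (coeff-⊛-distribˡ-⊕ p (h x ∷ []) (map h xs) a b)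
        (cong (ℤ._+_ (coeff (p ⊛ (h x ∷ [])) a b)) (coeff-⊛-map p h xs a b))

coeff-⊛-concatMap : ∀ p (F : A → LPoly) xs a b →
                    coeff (p ⊛ concatMap F xs) a b ≡ ∑[ x ← xs ] coeff (p ⊛ F x) a b
coeff-⊛-concatMap p F []       a b = cong (λ q → coeff q a b) (⊛-zeroʳ p)
coeff-⊛-concatMap p F (x ∷ xs) a b =
  trans (coeff-⊛-distribˡ-⊕ p (F x) (concatMap F xs) a b)
        (cong (ℤ._+_ (coeff (p ⊛ F x) a b)) (coeff-⊛-concatMap p F xs a b))

monoℤ : ℕ → ℕ → ℤ → Term
monoℤ N₁ N₂ z = (+ 1 , + N₁ ℤ.- z , z ℤ.- + N₂)

X₂-⊛-monoℤ : ∀ N₁ N₂ z → X₂ ⊛ (monoℤ N₁ N₂ z ∷ []) ≡ X₁ ⊛ (monoℤ N₁ N₂ (+ 1 ℤ.+ z) ∷ [])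
X₂-⊛-monoℤ N₁ N₂ z =
  cong₂ (λ e₁ e₂ → (+ 1 , e₁ , e₂) ∷ []) (exponent₁ (+ N₁) z) (exponent₂ (+ N₂) z)
  where
  exponent₁ : ∀ n z → + 0 ℤ.+ (n ℤ.- z) ≡ + 1 ℤ.+ (n ℤ.- (+ 1 ℤ.+ z))
  exponent₁ = solve-∀
  exponent₂ : ∀ n z → + 1 ℤ.+ (z ℤ.- n) ≡ + 0 ℤ.+ (+ 1 ℤ.+ z ℤ.- n)
  exponent₂ = solve-∀

X₂-⊛-s₁-monoℤ : ∀ N₁ N₂ z →
                X₂ ⊛ s₁ (monoℤ N₁ N₂ z ∷ []) ≡ X₁ ⊛ (monoℤ N₁ N₂ (+ suc (N₁ + N₂) ℤ.- z) ∷ [])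
X₂-⊛-s₁-monoℤ N₁ N₂ z =
  cong₂ (λ e₁ e₂ → (+ 1 , e₁ , e₂) ∷ []) (exponent₁ (+ N₁) (+ N₂) z) (exponent₂ (+ N₁) (+ N₂) z)
  where
  exponent₁ : ∀ n₁ n₂ z → + 0 ℤ.+ (z ℤ.- n₂) ≡ + 1 ℤ.+ (n₁ ℤ.- (+ 1 ℤ.+ (n₁ ℤ.+ n₂) ℤ.- z))
  exponent₁ = solve-∀
  exponent₂ : ∀ n₁ n₂ z → + 1 ℤ.+ (n₁ ℤ.- z) ≡ + 0 ℤ.+ (+ 1 ℤ.+ (n₁ ℤ.+ n₂) ℤ.- z ℤ.- n₂)
  exponent₂ = solve-∀

module CoefficientAt (N₁ N₂ : ℕ) (a b : ℤ) where

  γ : ℤ → ℤ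
  γ z = coeff (X₁ ⊛ (monoℤ N₁ N₂ z ∷ [])) a b

  coeff-[X₁⊖X₂]⊛-telescopes : ∀ (S : List ℕ) M →
    coeff ((X₁ ⊖ X₂) ⊛ concatMap (λ s → map (λ c → mono N₁ N₂ (s + c)) (range 0 M)) S) a b
      ≡ (∑[ s ← S ] γ (+ s)) ℤ.- (∑[ s ← S ] γ (+ (s + suc M)))
  coeff-[X₁⊖X₂]⊛-telescopes S M = begin
    coeff ((X₁ ⊖ X₂) ⊛ g) a b
      ≡⟨ cong (λ p → coeff p a b) (⊛-distribʳ-⊖ X₁ X₂ g) ⟩
    coeff (X₁ ⊛ g ⊖ X₂ ⊛ g) a b
      ≡⟨ coeff-⊖ (X₁ ⊛ g) (X₂ ⊛ g) a b ⟩
    coeff (X₁ ⊛ g) a b ℤ.- coeff (X₂ ⊛ g) a b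
      ≡⟨ cong₂ ℤ._-_ (expand X₁) (trans (expand X₂) (∑-cong S λ s → ∑-cong (upTo (suc M)) (X₂-shift s))) ⟩
    (∑[ s ← S ] ∑[ c ← upTo (suc M) ] γ (+ (s + c)))
      ℤ.- (∑[ s ← S ] ∑[ c ← upTo (suc M) ] γ (+ (s + suc c)))
      ≡⟨ ∑-telescope S (suc M) (λ s c → γ (+ (s + c))) ⟩
    (∑[ s ← S ] γ (+ (s + 0))) ℤ.- (∑[ s ← S ] γ (+ (s + suc M)))
      ≡⟨ cong (λ x → x ℤ.- (∑[ s ← S ] γ (+ (s + suc M))))
              (∑-cong S (λ s → cong (γ ∘ +_) (ℕ.+-identityʳ s))) ⟩
    (∑[ s ← S ] γ (+ s)) ℤ.- (∑[ s ← S ] γ (+ (s + suc M))) ∎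
    where
    g : LPoly
    g = concatMap (λ s → map (λ c → mono N₁ N₂ (s + c)) (range 0 M)) S
    expand : ∀ p → coeff (p ⊛ g) a b
                     ≡ ∑[ s ← S ] ∑[ c ← upTo (suc M) ] coeff (p ⊛ (mono N₁ N₂ (s + c) ∷ [])) a b
    expand p = trans (coeff-⊛-concatMap p _ S a b) (∑-cong S λ s →
      trans (coeff-⊛-map p _ (range 0 M) a b)
            (∑-map (0 ℕ.+_) (upTo (suc M)) (λ c → coeff (p ⊛ (mono N₁ N₂ (s + c) ∷ [])) a b)))
    X₂-shift : ∀ s c → coeff (X₂ ⊛ (mono N₁ N₂ (s + c) ∷ [])) a b ≡ γ (+ (s + suc c))
    X₂-shift s c = trans (cong (λ p → coeff p a b) (X₂-⊛-monoℤ N₁ N₂ (+ (s + c))))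
                         (cong (γ ∘ +_) (sym (ℕ.+-suc s c)))

  coeff-X₁⊛f⊖X₂⊛s₁f : ∀ (S : List ℕ) →
    coeff (X₁ ⊛ map (mono N₁ N₂) S ⊖ X₂ ⊛ s₁ (map (mono N₁ N₂) S)) a b
      ≡ (∑[ s ← S ] γ (+ s)) ℤ.- (∑[ s ← S ] γ (+ suc (N₁ + N₂) ℤ.- + s))
  coeff-X₁⊛f⊖X₂⊛s₁f S =
    trans (coeff-⊖ (X₁ ⊛ map (mono N₁ N₂) S) (X₂ ⊛ s₁ (map (mono N₁ N₂) S)) a b)
          (cong₂ ℤ._-_ (coeff-⊛-map X₁ (mono N₁ N₂) S a b) X₂-part)
    where
    X₂-part : coeff (X₂ ⊛ s₁ (map (mono N₁ N₂) S)) a b ≡ ∑[ s ← S ] γ (+ suc (N₁ + N₂) ℤ.- + s)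
    X₂-part = begin
      coeff (X₂ ⊛ map swapT (map (mono N₁ N₂) S)) a b
        ≡⟨ cong (λ q → coeff (X₂ ⊛ q) a b) (List.map-∘ S) ⟨
      coeff (X₂ ⊛ map (swapT ∘ mono N₁ N₂) S) a b
        ≡⟨ coeff-⊛-map X₂ (swapT ∘ mono N₁ N₂) S a b ⟩
      ∑[ s ← S ] coeff (X₂ ⊛ s₁ (mono N₁ N₂ s ∷ [])) a b
        ≡⟨ ∑-cong S (λ s → cong (λ q → coeff q a b) (X₂-⊛-s₁-monoℤ N₁ N₂ (+ s))) ⟩
      ∑[ s ← S ] γ (+ suc (N₁ + N₂) ℤ.- + s) ∎

lemma2p11 : (N₁ N₂ k : ℕ) (μ ν : Fin k → ℕ) →
              (∀ i → μ i ≤ ν i) →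
              totalμν k μ ν ≤ N₁ + N₂ →
              rhsPoly N₁ N₂ k μ ν IsPi₁Of fPoly N₁ N₂ k μ ν
lemma2p11 N₁ N₂ k μ ν μ≤ν T≤N₁+N₂ a b = begin
    coeff ((X₁ ⊖ X₂) ⊛ rhsPoly N₁ N₂ k μ ν) a b
  ≡⟨ coeff-[X₁⊖X₂]⊛-telescopes S (νlast N₁ N₂ k μ ν) ⟩
    (∑[ s ← S ] γ (+ s)) ℤ.- (∑[ s ← S ] γ (+ (s + suc (νlast N₁ N₂ k μ ν))))
  ≡⟨ cong (ℤ._-_ (∑[ s ← S ] γ (+ s)))
          (reflect-∑-shifted (N₁ + N₂) (boxSums-palindromic k μ ν μ≤ν) T≤N₁+N₂ γ) ⟩
    (∑[ s ← S ] γ (+ s)) ℤ.- (∑[ s ← S ] γ (+ suc (N₁ + N₂) ℤ.- + s))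
  ≡⟨ coeff-X₁⊛f⊖X₂⊛s₁f S ⟨
    coeff (X₁ ⊛ fPoly N₁ N₂ k μ ν ⊖ X₂ ⊛ s₁ (fPoly N₁ N₂ k μ ν)) a b ∎
  where
  open CoefficientAt N₁ N₂ a b
  S = boxSums k μ ν
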